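{- Let $\Gamma$ be a chain of cycles of genus $g\geq 2$ with torsion profile $\underline{m}=(m_2,\dots,m_g)$. Let $r\in\mathbb{Z}_{\geq 1}$ and $d\in\mathbb{Z}$ with $r-d+g\geq 2$. If there exists an $\underline{m}$-displacement tableau $t:[(g-d+r)\times(r+1)]\to\{1,\dots,g\}$, then there exists an $\underline{m}$-displacement tableau $t':[(g-d+2r-1)\times 2]\to\{1,\dots,g\}$.
   Context: A chain of cycles of genus $g$ is the metric graph constructed as follows: take $g$ metric graphs $C_1,\dots,C_g$, each isometric to a circle; on each $C_i$ choose two distinct points $v_i,w_i$; for $1\leq i\leq g-1$ connect $w_i$ and $v_{i+1}$ by a line segment. Its torsion profile $\underline{m}=(m_2,\dots,m_g)$ is defined by: letting $l_i$ be the length of $C_i$ and $l(v_i,w_i)$ the length of the clockwise arc on $C_i$ from $v_i$ to $w_i$, $m_i=0$ if $l_i$ is an irrational multiple of $l(v_i,w_i)$, and otherwise $m_i$ is the minimal positive integer such that $m_i\,l(v_i,w_i)$ is an integer multiple of $l_i$. For positive integers $a,b$, $[a\times b]$ denotes $\{1,\dots,a\}\times\{1,\dots,b\}$. An $\underline{m}$-displacement tableau on $[a\times b]$ is a function $t:[a\times b]\to\{1,\dots,g\}$ such that (i) $t$ is strictly increasing in each coordinate when the other coordinate is fixed, and (ii) if $t(x,y)=t(x',y')$ then $x-y\equiv x'-y' \pmod{m_{t(x,y)}}$ (congruence modulo $0$ meaning equality; the condition is vacuous for the value $1$, which can only occur at $(1,1)$). -}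

module Defs where

open import Data.Nat using (ℕ; _≤_; _<_)
open import Data.Integer using (ℤ; +_; _-_)
open import Data.Integer.Divisibility using (_∣_)
open import Data.Product using (_×_)
open import Relation.Binary.PropositionalEquality using (_≡_; _≢_)

InBox : ℕ → ℕ → ℕ → ℕ → Set
InBox a b x y = (1 ≤ x × x ≤ a) × (1 ≤ y × y ≤ b)

-- Congruence modulo m of integers; modulo 0 means equality (0 ∣ k ⇔ k ≡ 0).
_≡_[mod_] : ℤ → ℤ → ℕ → Set
u ≡ v [mod m ] = (+ m) ∣ (u - v)

-- A torsion profile (m₂,…,m_g) is encoded as m : ℕ → ℕ; only the values
-- m i for 2 ≤ i ≤ g are relevant.  For a chain of cycles, v_i ≠ w_i forces
-- m_i ≠ 1 (m_i = 0 or m_i ≥ 2).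
IsTorsionProfile : ℕ → (ℕ → ℕ) → Set
IsTorsionProfile g m = ∀ i → 2 ≤ i → i ≤ g → m i ≢ 1

-- An m-displacement tableau on [a × b] with values in {1,…,g}.
-- (t is a function ℕ → ℕ → ℕ; only its values on the box matter.)
record DisplacementTableau (g : ℕ) (m : ℕ → ℕ) (a b : ℕ) : Set where
  field
    t      : ℕ → ℕ → ℕ
    range  : ∀ x y → InBox a b x y → 1 ≤ t x y × t x y ≤ g
    incrˣ  : ∀ x x' y → InBox a b x y → InBox a b x' y → x < x' → t x y < t x' y
    incrʸ  : ∀ x y y' → InBox a b x y → InBox a b x y' → y < y' → t x y < t x y'
    disp   : ∀ x y x' y' → InBox a b x y → InBox a b x' y' → t x y ≡ t x' y' →
             ((+ x) - (+ y)) ≡ ((+ x') - (+ y')) [mod m (t x y) ]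

{-# OPTIONS --safe #-}
-- Let a, b ≥ 2 and N = a + b − 2. Run a lattice path Q₁, …, Q_N through [a × b] by unit steps down
-- or right, Q_k on the antidiagonal x + y = k + 2, and pair each Q_k with its left or upper
-- neighbour P_k (with P₁ = (1,1) and Q₁ the larger-valued of (1,2), (2,1)); row k of the new
-- tableau is (t P_k, t Q_k). Rows and the second column increase since P_k ≺ Q_k and the path is
-- monotone. The path is greedy: from Q_k = (x, y) it moves so that P_{k+1} is whichever of
-- (x+1, y−1), (x−1, y+1) has the smaller entry, and t P_k stays below both candidates, so the
-- first column increases. If t P_k = t Q_l, then l < k and Q_l ≤ Q_{k−1} componentwise, and
-- strictness of t puts Q_l in the column just right of P_k (after a down step) or the row just
-- below it (after a right step). In both cases the values of x − y at the two cells differ by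
-- ± ((k − 1) − (l − 2)), so the displacement condition carries over.
module Submission where

open import Defs

module TwoColumn where
  open import Data.Empty using (⊥-elim)
  open import Data.Integer as ℤ using (+_; _-_)
  import Data.Integer.Properties as ℤₚ
  open import Data.Integer.Tactic.RingSolver using (solve-∀)
  import Data.Nat.Divisibility as ℕ
  open import Data.Nat using (ℕ; zero; suc; pred; _+_; _≤_; _<_; _<?_; _≤?_; z≤n; s≤s)
  open import Data.Nat.Properties
  open import Data.Product using (_×_; _,_; proj₁; proj₂)
  open import Data.Sum using (inj₁; inj₂)
  open import Relation.Binary.Definitions using (Transitive; tri<; tri≈; tri>)
  open import Relation.Binary.PropositionalEquality
  open import Relation.Nullary using (yes; no)

  ≡-mod-refl : ∀ M z → z ≡ z [mod M ]
  ≡-mod-refl M z = subst (λ w → M ℕ.∣ ℤ.∣ w ∣) (sym (ℤₚ.+-inverseʳ z)) (M ℕ.∣0)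

  ≡-mod-sym : ∀ {M u v} → u ≡ v [mod M ] → v ≡ u [mod M ]
  ≡-mod-sym {M} {u} {v} = subst (M ℕ.∣_) (ℤₚ.∣i-j∣≡∣j-i∣ u v)

  ≡-mod-resp-cross-sums : ∀ {M} a b c d a′ b′ c′ d′ → a + d ≡ a′ + d′ → b + c ≡ b′ + c′ →
    (+ a - + b) ≡ (+ c - + d) [mod M ] → (+ a′ - + b′) ≡ (+ c′ - + d′) [mod M ]
  ≡-mod-resp-cross-sums {M} a b c d a′ b′ c′ d′ a+d≡ b+c≡ =
    subst (λ w → M ℕ.∣ ℤ.∣ w ∣) (begin
      (+ a - + b) - (+ c - + d)     ≡⟨ difference-of-differences (+ a) (+ b) (+ c) (+ d) ⟩
      + (a + d) - + (b + c)         ≡⟨ cong₂ (λ p q → + p - + q) a+d≡ b+c≡ ⟩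
      + (a′ + d′) - + (b′ + c′)     ≡⟨ difference-of-differences (+ a′) (+ b′) (+ c′) (+ d′) ⟨
      (+ a′ - + b′) - (+ c′ - + d′) ∎)
    where
      open ≡-Reasoning
      difference-of-differences : ∀ A B C D → (A - B) - (C - D) ≡ (A ℤ.+ D) - (B ℤ.+ C)
      difference-of-differences = solve-∀

  module _ {A : Set} (_∼_ : A → A → Set) (∼-trans : Transitive _∼_) {N : ℕ} (f : ℕ → A)
           (f-step : ∀ {k} → 1 ≤ k → suc k ≤ N → f k ∼ f (suc k)) where

    stepwise⇒related : ∀ {k l} → 1 ≤ k → k < l → l ≤ N → f k ∼ f l
    stepwise⇒related {k} {suc l} 1≤k (s≤s k≤l) 1+l≤N with m≤n⇒m<n∨m≡n k≤l
    ... | inj₁ k<l = ∼-trans (stepwise⇒related 1≤k k<l (≤-trans (n≤1+n l) 1+l≤N))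
                             (f-step (≤-trans 1≤k (<⇒≤ k<l)) 1+l≤N)
    ... | inj₂ refl = f-step 1≤k 1+l≤N

  increasing⇒injective : ∀ {N} (f : ℕ → ℕ) → (∀ {k l} → 1 ≤ k → k < l → l ≤ N → f k < f l) →
    ∀ {k l} → 1 ≤ k → k ≤ N → 1 ≤ l → l ≤ N → f k ≡ f l → k ≡ l
  increasing⇒injective f f-< {k} {l} 1≤k k≤N 1≤l l≤N fk≡fl with <-cmp k l
  ... | tri< k<l _ _ = ⊥-elim (<⇒≢ (f-< 1≤k k<l l≤N) fk≡fl)
  ... | tri≈ _ k≡l _ = k≡l
  ... | tri> _ _ l<k = ⊥-elim (>⇒≢ (f-< 1≤l l<k k≤N) fk≡fl)

  data Column : ℕ → Set where
    first  : Column 1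
    second : Column 2

  column : ∀ {y} → 1 ≤ y → y ≤ 2 → Column y
  column (s≤s z≤n) (s≤s z≤n)       = first
  column (s≤s z≤n) (s≤s (s≤s z≤n)) = second

  fromColumns : ∀ {g m N} (u v : ℕ → ℕ) →
    (∀ {k} → 1 ≤ k → k ≤ N → 1 ≤ u k × v k ≤ g) →
    (∀ {k} → 1 ≤ k → k ≤ N → u k < v k) →
    (∀ {k} → 1 ≤ k → suc k ≤ N → u k < u (suc k)) →
    (∀ {k} → 1 ≤ k → suc k ≤ N → v k < v (suc k)) →
    (∀ {k l} → 1 ≤ k → k ≤ N → 1 ≤ l → l ≤ N → u k ≡ v l →
       (+ k - + 1) ≡ (+ l - + 2) [mod m (u k) ]) →
    DisplacementTableau g m N 2
  fromColumns {g} {m} {N} u v bounds u<v u-step v-step crossing = record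
    { t = entry ; range = range ; incrˣ = incrˣ ; incrʸ = incrʸ ; disp = disp }
    where
      entry : ℕ → ℕ → ℕ
      entry k 1 = u k
      entry k _ = v k

      u-< : ∀ {k l} → 1 ≤ k → k < l → l ≤ N → u k < u l
      u-< = stepwise⇒related _<_ <-trans u u-step

      v-< : ∀ {k l} → 1 ≤ k → k < l → l ≤ N → v k < v l
      v-< = stepwise⇒related _<_ <-trans v v-step

      range : ∀ k y → InBox N 2 k y → 1 ≤ entry k y × entry k y ≤ g
      range k y ((1≤k , k≤N) , (1≤y , y≤2)) with column 1≤y y≤2
      ... | first  = proj₁ (bounds 1≤k k≤N) , <⇒≤ (<-≤-trans (u<v 1≤k k≤N) (proj₂ (bounds 1≤k k≤N)))
      ... | second = <⇒≤ (≤-<-trans (proj₁ (bounds 1≤k k≤N)) (u<v 1≤k k≤N)) , proj₂ (bounds 1≤k k≤N)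

      incrˣ : ∀ k k′ y → InBox N 2 k y → InBox N 2 k′ y → k < k′ → entry k y < entry k′ y
      incrˣ k k′ y ((1≤k , _) , (1≤y , y≤2)) ((_ , k′≤N) , _) k<k′ with column 1≤y y≤2
      ... | first  = u-< 1≤k k<k′ k′≤N
      ... | second = v-< 1≤k k<k′ k′≤N

      incrʸ : ∀ k y y′ → InBox N 2 k y → InBox N 2 k y′ → y < y′ → entry k y < entry k y′
      incrʸ k y y′ ((1≤k , k≤N) , (1≤y , y≤2)) (_ , (1≤y′ , y′≤2)) y<y′
        with column 1≤y y≤2 | column 1≤y′ y′≤2
      ... | first  | second = u<v 1≤k k≤N
      ... | first  | first  = ⊥-elim (<-irrefl refl y<y′)
      ... | second | _      = ⊥-elim (<-irrefl refl (<-≤-trans y<y′ y′≤2))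

      disp : ∀ k y k′ y′ → InBox N 2 k y → InBox N 2 k′ y′ → entry k y ≡ entry k′ y′ →
             (+ k - + y) ≡ (+ k′ - + y′) [mod m (entry k y) ]
      disp k y k′ y′ ((1≤k , k≤N) , (1≤y , y≤2)) ((1≤k′ , k′≤N) , (1≤y′ , y′≤2)) same
        with column 1≤y y≤2 | column 1≤y′ y′≤2
      ... | first  | first
        rewrite increasing⇒injective u u-< 1≤k k≤N 1≤k′ k′≤N same = ≡-mod-refl _ (+ k′ - + 1)
      ... | second | second
        rewrite increasing⇒injective v v-< 1≤k k≤N 1≤k′ k′≤N same = ≡-mod-refl _ (+ k′ - + 2)
      ... | first  | second = crossing 1≤k k≤N 1≤k′ k′≤N same
      ... | second | first  = subst (λ e → (+ k - + 2) ≡ (+ k′ - + 1) [mod m e ]) (sym same)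
                                (≡-mod-sym {u = + k′ - + 1} (crossing 1≤k′ k′≤N 1≤k k≤N (sym same)))

  Cell : Set
  Cell = ℕ × ℕ

  level : Cell → ℕ
  level (x , y) = x + y

  _≤ᶜ_ : Cell → Cell → Set
  (x , y) ≤ᶜ (x′ , y′) = x ≤ x′ × y ≤ y′

  ≤ᶜ-trans : Transitive _≤ᶜ_
  ≤ᶜ-trans (x≤x′ , y≤y′) (x′≤x″ , y′≤y″) = ≤-trans x≤x′ x′≤x″ , ≤-trans y≤y′ y′≤y″

  data _≺_ : Cell → Cell → Set where
    below : ∀ {x y x′ y′} → x < x′ → y ≤ y′ → (x , y) ≺ (x′ , y′)
    right : ∀ {x y x′ y′} → x ≤ x′ → y < y′ → (x , y) ≺ (x′ , y′)

  data Side : Set where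
    left above : Side

  neighbour : Side → Cell → Cell
  neighbour left  (x , y) = x , pred y
  neighbour above (x , y) = pred x , y

  Domino : Set
  Domino = Side × Cell

  cell₁ : Domino → Cell
  cell₁ (s , c) = neighbour s c

  cell₂ : Domino → Cell
  cell₂ (s , c) = c

  data _↝_ : Domino → Domino → Set where
    stepDown  : ∀ {s x y} → (s , (x , y)) ↝ (left , (suc x , y))
    stepRight : ∀ {s x y} → (s , (x , y)) ↝ (above , (x , suc y))

  ↝-≤ᶜ : ∀ {D D′} → D ↝ D′ → cell₂ D ≤ᶜ cell₂ D′
  ↝-≤ᶜ (stepDown {x = x})  = n≤1+n x , ≤-refl
  ↝-≤ᶜ (stepRight {y = y}) = ≤-refl , n≤1+n y

  ↝-≺ : ∀ {D D′} → D ↝ D′ → cell₂ D ≺ cell₂ D′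
  ↝-≺ stepDown  = below ≤-refl ≤-refl
  ↝-≺ stepRight = right ≤-refl ≤-refl

  pred-< : ∀ {n} → 1 ≤ pred n → pred n < n
  pred-< {suc n} _ = ≤-refl

  pred-level : ∀ u {v l} → 1 ≤ pred u → u + v ≡ l + 2 → pred u + v ≡ 1 + l
  pred-level (suc u) {v} {l} _ u+v≡ = suc-injective (trans u+v≡ (+-comm l 2))

  module Tableau {g m a b} (T : DisplacementTableau g m a b) where
    open DisplacementTableau T

    t⟨_⟩ : Cell → ℕ
    t⟨ x , y ⟩ = t x y

    Inside : Cell → Set
    Inside (x , y) = InBox a b x y

    t-≤ˣ : ∀ {x x′ y} → InBox a b x y → InBox a b x′ y → x ≤ x′ → t x y ≤ t x′ y
    t-≤ˣ {x} {x′} {y} p p′ x≤x′ with m≤n⇒m<n∨m≡n x≤x′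
    ... | inj₁ x<x′ = <⇒≤ (incrˣ x x′ y p p′ x<x′)
    ... | inj₂ refl = ≤-refl

    t-≤ʸ : ∀ {x y y′} → InBox a b x y → InBox a b x y′ → y ≤ y′ → t x y ≤ t x y′
    t-≤ʸ {x} {y} {y′} p p′ y≤y′ with m≤n⇒m<n∨m≡n y≤y′
    ... | inj₁ y<y′ = <⇒≤ (incrʸ x y y′ p p′ y<y′)
    ... | inj₂ refl = ≤-refl

    t-mono : ∀ {c c′} → Inside c → Inside c′ → c ≺ c′ → t⟨ c ⟩ < t⟨ c′ ⟩
    t-mono {x , y} {x′ , y′} p@((1≤x , _) , (1≤y , _)) p′@((_ , x′≤a) , (_ , y′≤b)) (below x<x′ y≤y′) =
      <-≤-trans (incrˣ x x′ y p corner x<x′) (t-≤ʸ corner p′ y≤y′)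
      where
        corner : InBox a b x′ y
        corner = (≤-trans 1≤x (<⇒≤ x<x′) , x′≤a) , (1≤y , ≤-trans y≤y′ y′≤b)
    t-mono {x , y} {x′ , y′} p@((1≤x , _) , (1≤y , _)) p′@((_ , x′≤a) , (_ , y′≤b)) (right x≤x′ y<y′) =
      ≤-<-trans (t-≤ˣ p corner x≤x′) (incrʸ x′ y y′ corner p′ y<y′)
      where
        corner : InBox a b x′ y
        corner = (≤-trans 1≤x x≤x′ , x′≤a) , (1≤y , ≤-trans (<⇒≤ y<y′) y′≤b)

    neighbour-≺ : ∀ s c → Inside (neighbour s c) → neighbour s c ≺ c
    neighbour-≺ left  (x , y) (_ , (1≤y-1 , _)) = right ≤-refl (pred-< 1≤y-1)
    neighbour-≺ above (x , y) ((1≤x-1 , _) , _) = below (pred-< 1≤x-1) ≤-refl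

    record Placed (k : ℕ) (D : Domino) : Set where
      field
        inside₁  : Inside (cell₁ D)
        inside₂  : Inside (cell₂ D)
        on-level : level (cell₂ D) ≡ k + 2

      cell₁<cell₂ : t⟨ cell₁ D ⟩ < t⟨ cell₂ D ⟩
      cell₁<cell₂ = t-mono inside₁ inside₂ (neighbour-≺ (proj₁ D) (proj₂ D) inside₁)

    open Placed

    crossing : ∀ {D₀ D₁ D₂ k l} → D₀ ↝ D₁ → cell₂ D₂ ≤ᶜ cell₂ D₀ → Placed k D₁ → Placed l D₂ →
      t⟨ cell₁ D₁ ⟩ ≡ t⟨ cell₂ D₂ ⟩ → (+ k - + 1) ≡ (+ l - + 2) [mod m t⟨ cell₁ D₁ ⟩ ]
    crossing {_ , (x , y)} {_} {_ , (x₂ , y₂)} {k} {l} stepDown (x₂≤x , y₂≤y) P₁ P₂ same with y₂ <? y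
    ... | yes y₂<y = ⊥-elim (<⇒≢ (t-mono (inside₂ P₂) (inside₁ P₁) (below (s≤s x₂≤x) (<⇒≤pred y₂<y)))
                                 (sym same))
    ... | no y₂≮y with ≤-antisym y₂≤y (≮⇒≥ y₂≮y)
    ...   | refl = ≡-mod-resp-cross-sums (suc x) (pred y) x₂ y k 1 l 2 (on-level P₁)
                     (pred-level y (proj₁ (proj₂ (inside₁ P₁))) (trans (+-comm y x₂) (on-level P₂)))
                     (disp (suc x) (pred y) x₂ y (inside₁ P₁) (inside₂ P₂) same)
    crossing {_ , (x , y)} {_} {_ , (x₂ , y₂)} {k} {l} stepRight (x₂≤x , y₂≤y) P₁ P₂ same with x₂ <? x
    ... | yes x₂<x = ⊥-elim (<⇒≢ (t-mono (inside₂ P₂) (inside₁ P₁) (right (<⇒≤pred x₂<x) (s≤s y₂≤y)))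
                                 (sym same))
    ... | no x₂≮x with ≤-antisym x₂≤x (≮⇒≥ x₂≮x)
    ...   | refl = ≡-mod-resp-cross-sums x y₂ (pred x) (suc y) k 1 l 2 (on-level P₁)
                     (trans (+-comm y₂ (pred x))
                            (pred-level x (proj₁ (proj₁ (inside₁ P₁))) (on-level P₂)))
                     (≡-mod-sym {u = + pred x - + suc y}
                       (disp (pred x) (suc y) x y₂ (inside₁ P₁) (inside₂ P₂) same))

  module Greedy {g m a b N} (T : DisplacementTableau g m a b)
                (2≤a : 2 ≤ a) (2≤b : 2 ≤ b) (size : a + b ≡ N + 2) where
    open DisplacementTableau T
    open Tableau T
    open Placed

    data Choice (x y : ℕ) : Set where
      goDown  : x < a → (y < b → t (suc x) (pred y) ≤ t (pred x) (suc y)) → Choice x y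
      goRight : (x < a → y < b × t (pred x) (suc y) < t (suc x) (pred y)) → Choice x y

    choose : ∀ x y → Choice x y
    choose x y with x <? a
    ... | no x≮a = goRight (λ x<a → ⊥-elim (x≮a x<a))
    ... | yes x<a with y <? b
    ...   | no y≮b = goDown x<a (λ y<b → ⊥-elim (y≮b y<b))
    ...   | yes y<b with t (suc x) (pred y) ≤? t (pred x) (suc y)
    ...     | yes down-smaller = goDown x<a (λ _ → down-smaller)
    ...     | no down-larger   = goRight (λ _ → y<b , ≰⇒> down-larger)

    follow : ∀ {x y} → Choice x y → Domino
    follow {x} {y} (goDown _ _) = left , (suc x , y)
    follow {x} {y} (goRight _)  = above , (x , suc y)

    step : Domino → Domino
    step (_ , (x , y)) = follow (choose x y)

    data Opening : Set where
      leftFirst  : t 2 1 ≤ t 1 2 → Opening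
      aboveFirst : t 1 2 < t 2 1 → Opening

    opening : Opening
    opening with t 2 1 ≤? t 1 2
    ... | yes left-smaller = leftFirst left-smaller
    ... | no left-larger   = aboveFirst (≰⇒> left-larger)

    firstDomino : Opening → Domino
    firstDomino (leftFirst _)  = left , (1 , 2)
    firstDomino (aboveFirst _) = above , (2 , 1)

    secondDomino : Opening → Domino
    secondDomino (leftFirst _)  = left , (2 , 2)
    secondDomino (aboveFirst _) = above , (2 , 2)

    domino : ℕ → Domino
    domino zero                = firstDomino opening  -- junk: rows are numbered from 1
    domino (suc zero)          = firstDomino opening
    domino (suc (suc zero))    = secondDomino opening
    domino (suc (suc (suc k))) = step (domino (suc (suc k)))

    domino-↝ : ∀ {k} → 1 ≤ k → domino k ↝ domino (suc k)
    domino-↝ {suc zero} _    = opening-↝ opening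
      where
        opening-↝ : ∀ o → firstDomino o ↝ secondDomino o
        opening-↝ (leftFirst _)  = stepDown
        opening-↝ (aboveFirst _) = stepRight
    domino-↝ {suc (suc k)} _ = follow-↝ (choose _ _)
      where
        follow-↝ : ∀ {s x y} (δ : Choice x y) → (s , (x , y)) ↝ follow δ
        follow-↝ (goDown _ _) = stepDown
        follow-↝ (goRight _)  = stepRight

    row : Domino → ℕ
    row D = proj₁ (cell₂ D)

    col : Domino → ℕ
    col D = proj₂ (cell₂ D)

    -- (suc x , pred y) and (pred x , suc y) are the first-column cells after a step down or right
    -- from the path cell (x , y).
    record Greedy (k : ℕ) (D : Domino) : Set where
      field
        2≤row     : 2 ≤ row D
        row≤a     : row D ≤ a
        2≤col     : 2 ≤ col D
        col≤b     : col D ≤ b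
        on-level  : level (cell₂ D) ≡ k + 2
        <-down    : row D < a → t⟨ cell₁ D ⟩ < t (suc (row D)) (pred (col D))
        <-right   : col D < b → t⟨ cell₁ D ⟩ < t (pred (row D)) (suc (col D))

    open Greedy

    greedy⇒placed : ∀ {k D} → Greedy k D → Placed k D
    greedy⇒placed {D = s , (x , y)} G = record
      { inside₁ = inside-neighbour s ; inside₂ = inside-here ; on-level = on-level G }
      where
        inside-here : Inside (x , y)
        inside-here = (≤-trans (s≤s z≤n) (2≤row G) , row≤a G) , (≤-trans (s≤s z≤n) (2≤col G) , col≤b G)

        inside-neighbour : ∀ s → Inside (neighbour s (x , y))
        inside-neighbour left  =
          proj₁ inside-here , (pred-mono-≤ (2≤col G) , ≤-trans pred[n]≤n (col≤b G))
        inside-neighbour above =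
          (pred-mono-≤ (2≤row G) , ≤-trans pred[n]≤n (row≤a G)) , proj₂ inside-here

    descend : ∀ {k s x y} → Greedy k (s , (x , y)) → x < a →
      (y < b → t (suc x) (pred y) ≤ t (pred x) (suc y)) → Greedy (suc k) (left , (suc x , y))
    descend {x = x} {y} G x<a down-smaller = record
      { 2≤row = ≤-trans (2≤row G) (n≤1+n x) ; row≤a = x<a ; 2≤col = 2≤col G ; col≤b = col≤b G
      ; on-level = cong suc (on-level G)
      ; <-down  = λ 1+x<a → t-mono here ((s≤s z≤n , 1+x<a) , proj₂ here) (below ≤-refl ≤-refl)
      ; <-right = λ y<b → ≤-<-trans (down-smaller y<b)
          (t-mono ((1≤x-1 , ≤-trans pred[n]≤n (<⇒≤ x<a)) , (s≤s z≤n , y<b))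
                  ((≤-trans (s≤s z≤n) (2≤row G) , <⇒≤ x<a) , (s≤s z≤n , y<b))
                  (below (pred-< 1≤x-1) ≤-refl))
      }
      where
        1≤x-1 : 1 ≤ pred x
        1≤x-1 = pred-mono-≤ (2≤row G)
        here : Inside (suc x , pred y)
        here = (s≤s z≤n , x<a) , (pred-mono-≤ (2≤col G) , ≤-trans pred[n]≤n (col≤b G))

    a≤row⇒col<b : ∀ {k x y} → x + y ≡ k + 2 → suc k ≤ N → a ≤ x → y < b
    a≤row⇒col<b {k} {x} {y} x+y≡ k<N a≤x = +-cancelˡ-< x y b (begin-strict
      x + y   ≡⟨ x+y≡ ⟩
      k + 2   <⟨ +-monoˡ-< 2 k<N ⟩
      N + 2   ≡⟨ size ⟨
      a + b   ≤⟨ +-monoˡ-≤ b a≤x ⟩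
      x + b   ∎)
      where open ≤-Reasoning

    turnRight : ∀ {k s x y} → Greedy k (s , (x , y)) → y < b →
      (x < a → t (pred x) (suc y) < t (suc x) (pred y)) → Greedy (suc k) (above , (x , suc y))
    turnRight {x = x} {y} G y<b right-smaller = record
      { 2≤row = 2≤row G ; row≤a = row≤a G ; 2≤col = ≤-trans (2≤col G) (n≤1+n y) ; col≤b = y<b
      ; on-level = trans (+-suc x y) (cong suc (on-level G))
      ; <-down  = λ x<a → <-trans (right-smaller x<a)
          (t-mono ((s≤s z≤n , x<a) , (1≤y-1 , ≤-trans pred[n]≤n (<⇒≤ y<b)))
                  ((s≤s z≤n , x<a) , (≤-trans (s≤s z≤n) (2≤col G) , <⇒≤ y<b))
                  (right ≤-refl (pred-< 1≤y-1)))
      ; <-right = λ 1+y<b → t-mono here (proj₁ here , (s≤s z≤n , 1+y<b)) (right ≤-refl ≤-refl)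
      }
      where
        1≤y-1 : 1 ≤ pred y
        1≤y-1 = pred-mono-≤ (2≤col G)
        here : Inside (pred x , suc y)
        here = (pred-mono-≤ (2≤row G) , ≤-trans pred[n]≤n (row≤a G)) , (s≤s z≤n , y<b)

    follow-greedy : ∀ {k s x y} → Greedy k (s , (x , y)) → suc k ≤ N → (δ : Choice x y) →
      Greedy (suc k) (follow δ) × t⟨ neighbour s (x , y) ⟩ < t⟨ cell₁ (follow δ) ⟩
    follow-greedy G _ (goDown x<a down-smaller) = descend G x<a down-smaller , <-down G x<a
    follow-greedy {x = x} {y} G k<N (goRight right-smaller) =
      turnRight G y<b (λ x<a → proj₂ (right-smaller x<a)) , <-right G y<b
      where
        y<b : y < b
        y<b with x <? a
        ... | yes x<a = proj₁ (right-smaller x<a)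
        ... | no x≮a  = a≤row⇒col<b (on-level G) k<N (≮⇒≥ x≮a)

    inside₁₁ : Inside (1 , 1)
    inside₁₁ = (≤-refl , ≤-trans (n≤1+n 1) 2≤a) , (≤-refl , ≤-trans (n≤1+n 1) 2≤b)

    inside₂₁ : Inside (2 , 1)
    inside₂₁ = (s≤s z≤n , 2≤a) , proj₂ inside₁₁

    inside₁₂ : Inside (1 , 2)
    inside₁₂ = proj₁ inside₁₁ , (s≤s z≤n , 2≤b)

    opening-placed : ∀ o → Placed 1 (firstDomino o)
    opening-placed (leftFirst _)  = record { inside₁ = inside₁₁ ; inside₂ = inside₁₂ ; on-level = refl }
    opening-placed (aboveFirst _) = record { inside₁ = inside₁₁ ; inside₂ = inside₂₁ ; on-level = refl }

    opening-greedy : ∀ o → Greedy 2 (secondDomino o)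
    opening-greedy (leftFirst left-smaller) = record
      { 2≤row = ≤-refl ; row≤a = 2≤a ; 2≤col = ≤-refl ; col≤b = 2≤b ; on-level = refl
      ; <-down  = λ 2<a → t-mono inside₂₁ ((s≤s z≤n , 2<a) , proj₂ inside₁₁) (below ≤-refl ≤-refl)
      ; <-right = λ 2<b → ≤-<-trans left-smaller
          (t-mono inside₁₂ (proj₁ inside₁₁ , (s≤s z≤n , 2<b)) (right ≤-refl ≤-refl))
      }
    opening-greedy (aboveFirst above-smaller) = record
      { 2≤row = ≤-refl ; row≤a = 2≤a ; 2≤col = ≤-refl ; col≤b = 2≤b ; on-level = refl
      ; <-down  = λ 2<a → <-trans above-smaller
          (t-mono inside₂₁ ((s≤s z≤n , 2<a) , proj₂ inside₁₁) (below ≤-refl ≤-refl))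
      ; <-right = λ 2<b → t-mono inside₁₂ (proj₁ inside₁₁ , (s≤s z≤n , 2<b)) (right ≤-refl ≤-refl)
      }

    opening-increases : ∀ o → t⟨ cell₁ (firstDomino o) ⟩ < t⟨ cell₁ (secondDomino o) ⟩
    opening-increases (leftFirst _)  = t-mono inside₁₁ inside₂₁ (below ≤-refl ≤-refl)
    opening-increases (aboveFirst _) = t-mono inside₁₁ inside₁₂ (right ≤-refl ≤-refl)

    domino-greedy : ∀ {k} → 2 + k ≤ N → Greedy (2 + k) (domino (2 + k))
    domino-greedy {zero} _      = opening-greedy opening
    domino-greedy {suc k} k<N =
      proj₁ (follow-greedy (domino-greedy (≤-trans (n≤1+n _) k<N)) k<N (choose _ _))

    domino-placed : ∀ {k} → 1 ≤ k → k ≤ N → Placed k (domino k)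
    domino-placed {suc zero} _ _         = opening-placed opening
    domino-placed {suc (suc k)} _ k≤N = greedy⇒placed (domino-greedy k≤N)

    column₁ : ℕ → ℕ
    column₁ k = t⟨ cell₁ (domino k) ⟩

    column₂ : ℕ → ℕ
    column₂ k = t⟨ cell₂ (domino k) ⟩

    column-bounds : ∀ {k} → 1 ≤ k → k ≤ N → 1 ≤ column₁ k × column₂ k ≤ g
    column-bounds 1≤k k≤N = proj₁ (range _ _ (inside₁ P)) , proj₂ (range _ _ (inside₂ P))
      where P = domino-placed 1≤k k≤N

    column₁<column₂ : ∀ {k} → 1 ≤ k → k ≤ N → column₁ k < column₂ k
    column₁<column₂ 1≤k k≤N = cell₁<cell₂ (domino-placed 1≤k k≤N)

    column₁-step : ∀ {k} → 1 ≤ k → suc k ≤ N → column₁ k < column₁ (suc k)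
    column₁-step {suc zero} _ _        = opening-increases opening
    column₁-step {suc (suc k)} _ k<N =
      proj₂ (follow-greedy (domino-greedy (≤-trans (n≤1+n _) k<N)) k<N (choose _ _))

    column₂-step : ∀ {k} → 1 ≤ k → suc k ≤ N → column₂ k < column₂ (suc k)
    column₂-step 1≤k k<N = t-mono (inside₂ (domino-placed 1≤k (≤-trans (n≤1+n _) k<N)))
                                  (inside₂ (domino-placed (s≤s z≤n) k<N)) (↝-≺ (domino-↝ 1≤k))

    path-≤ᶜ : ∀ {l k} → 1 ≤ l → l ≤ k → cell₂ (domino l) ≤ᶜ cell₂ (domino k)
    path-≤ᶜ {l} {k} 1≤l l≤k with m≤n⇒m<n∨m≡n l≤k
    ... | inj₁ l<k  = stepwise⇒related _≤ᶜ_ ≤ᶜ-trans (λ j → cell₂ (domino j))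
                        (λ 1≤j _ → ↝-≤ᶜ (domino-↝ 1≤j)) 1≤l l<k ≤-refl
    ... | inj₂ refl = ≤-refl , ≤-refl

    column-crossing : ∀ {k l} → 1 ≤ k → k ≤ N → 1 ≤ l → l ≤ N → column₁ k ≡ column₂ l →
      (+ k - + 1) ≡ (+ l - + 2) [mod m (column₁ k) ]
    column-crossing {suc k} {l} 1≤k k≤N 1≤l l≤N same with <-cmp l (suc k)
    ... | tri< (s≤s l≤k) _ _ = crossing (domino-↝ (≤-trans 1≤l l≤k)) (path-≤ᶜ 1≤l l≤k)
                                 (domino-placed 1≤k k≤N) (domino-placed 1≤l l≤N) same
    ... | tri≈ _ refl _ = ⊥-elim (<⇒≢ (column₁<column₂ 1≤k k≤N) same)
    ... | tri> _ _ k<l  = ⊥-elim (<⇒≢ (<-trans (column₁<column₂ 1≤k k≤N)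
                            (stepwise⇒related _<_ <-trans column₂ column₂-step 1≤k k<l l≤N)) same)

    tableau : DisplacementTableau g m N 2
    tableau = fromColumns column₁ column₂ column-bounds column₁<column₂
                          column₁-step column₂-step column-crossing


open import Data.Nat using (ℕ; _≤_)
open import Data.Integer using (ℤ; +_; _-_; _+_; ∣_∣) renaming (_≤_ to _≤ℤ_)
open import Data.Nat using (suc; z≤n; s≤s)
open import Data.Integer using (+≤+)
import Data.Nat as ℕ using (_+_; _*_)
import Data.Nat.Properties as ℕₚ
import Data.Integer.Properties as ℤ
open import Data.Integer.Tactic.RingSolver using (solve-∀)
open import Data.Product using (_×_; _,_)
open import Relation.Binary.PropositionalEquality using (_≡_; sym; trans; cong; subst; module ≡-Reasoning)

dimensions : ∀ g r d → (+ 2) ≤ℤ ((+ suc r) - d) + (+ g) →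
  2 ≤ ∣ ((+ g) - d) + (+ suc r) ∣ ×
  ∣ ((+ g) - d) + (+ suc r) ∣ ℕ.+ (suc r ℕ.+ 1) ≡ ∣ (((+ g) - d) + (+ (2 ℕ.* suc r))) - (+ 1) ∣ ℕ.+ 2
dimensions g r d 2≤r-d+g = ℤ.drop‿+≤+ (subst (+ 2 ≤ℤ_) (sym +∣w∣≡w) 2≤w) , sizes
  where
    open ≡-Reasoning
    w : ℤ
    w = ((+ g) - d) + (+ suc r)

    2≤w : + 2 ≤ℤ w
    2≤w = subst (+ 2 ≤ℤ_) (reorder (+ g) d (+ suc r)) 2≤r-d+g
      where
        reorder : ∀ G D R → (R - D) + G ≡ (G - D) + R
        reorder = solve-∀

    +∣w∣≡w : + ∣ w ∣ ≡ w
    +∣w∣≡w = ℤ.0≤i⇒+∣i∣≡i (ℤ.≤-trans (+≤+ z≤n) 2≤w)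

    w′≡w+r : (((+ g) - d) + (+ (2 ℕ.* suc r))) - (+ 1) ≡ w + (+ r)
    w′≡w+r = trans (cong (λ n → (((+ g) - d) + (+ (suc r ℕ.+ n))) - (+ 1)) (ℕₚ.+-identityʳ (suc r)))
                   (widen (+ g) d (+ r))
      where
        widen : ∀ G D R → ((G - D) + ((+ 1 + R) + (+ 1 + R))) - (+ 1) ≡ ((G - D) + (+ 1 + R)) + R
        widen = solve-∀

    sizes : ∣ w ∣ ℕ.+ (suc r ℕ.+ 1) ≡ ∣ (((+ g) - d) + (+ (2 ℕ.* suc r))) - (+ 1) ∣ ℕ.+ 2
    sizes = begin
      ∣ w ∣ ℕ.+ (suc r ℕ.+ 1)   ≡⟨ cong (∣ w ∣ ℕ.+_) (trans (ℕₚ.+-comm (suc r) 1) (ℕₚ.+-comm 2 r)) ⟩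
      ∣ w ∣ ℕ.+ (r ℕ.+ 2)       ≡⟨ ℕₚ.+-assoc ∣ w ∣ r 2 ⟨
      ∣ + ∣ w ∣ + + r ∣ ℕ.+ 2   ≡⟨ cong (λ i → ∣ i + + r ∣ ℕ.+ 2) +∣w∣≡w ⟩
      ∣ w + + r ∣ ℕ.+ 2         ≡⟨ cong (λ i → ∣ i ∣ ℕ.+ 2) w′≡w+r ⟨
      ∣ (((+ g) - d) + (+ (2 ℕ.* suc r))) - (+ 1) ∣ ℕ.+ 2 ∎

theorem2 : (g : ℕ) → 2 ≤ g → (m : ℕ → ℕ) → IsTorsionProfile g m →
    (r : ℕ) → 1 ≤ r → (d : ℤ) → (+ 2) ≤ℤ ((+ r) - d) + (+ g) →
    DisplacementTableau g m ∣ ((+ g) - d) + (+ r) ∣ (r Data.Nat.+ 1) →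
    DisplacementTableau g m ∣ (((+ g) - d) + (+ (2 Data.Nat.* r))) - (+ 1) ∣ 2
theorem2 g _ m _ (suc r) (s≤s z≤n) d 2≤w T =
  let 2≤a , sizes = dimensions g r d 2≤w in
  TwoColumn.Greedy.tableau T 2≤a (s≤s (ℕₚ.m≤n+m 1 r)) sizes
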